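{- Let $\Delta$ be a positive integer and let $H = (h_{ij}) \in \mathbb{Z}^{n\times n}$ be a matrix in Hermite Normal Form with $1 < \det(H) \leq \Delta$; in particular $H$ is lower triangular ($h_{ij}=0$ for $j>i$). Let $1 \leq q \leq n$ be such that $h_{ii} = 1$ for $i \leq n-q$ and $h_{ii} > 1$ for $i \geq n-q+1$. Let $h'_{ij}$ denote the entry in row $i$ and column $j$ of $H^{ -1}$. Then: (a) $q \leq \log_2(\Delta)$; (b) every column of $H^{ -1}$ has at most $q+1$ nonzero entries; (c) each $h'_{ij}$ is an integer multiple of $\frac{1}{\det(H)}$; (d) $|h'_{ij}| \leq \Delta^{\log_2(\Delta) - 1}\,(\lceil \log_2(\Delta)\rceil)!$ for all $i,j$.
   Context: A matrix $H \in \mathbb{Z}^{n\times n}$ is in (lower triangular) Hermite Normal Form if $h_{ij} = 0$ for $j > i$, $h_{ii} > 0$ for all $i$, and $0 \leq h_{ij} < h_{ii}$ for all $j < i$. -}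

module Defs where

open import Data.Nat as ℕ using (ℕ; zero; suc)
open import Data.Fin using (Fin; zero; suc; toℕ; punchIn)
open import Data.Fin.Base using (_<_)
open import Data.Integer as ℤ using (ℤ; +_)
open import Data.Rational as ℚ using (ℚ; 0ℚ; 1ℚ)
open import Data.Rational.Properties using (_≟_)
open import Data.List using (List; length; filter)
open import Data.List.Base using (allFin)
open import Relation.Nullary.Decidable using (¬?)
open import Relation.Binary.PropositionalEquality using (_≡_)
open import Relation.Nullary using (yes; no)
open import Data.Product using (_×_)
import Data.Fin as Fin

-- Square matrices as functions (row index, column index).
Mat : Set → ℕ → Set
Mat A n = Fin n → Fin n → A

sumℤ : ∀ {n} → (Fin n → ℤ) → ℤ
sumℤ {zero}  f = + 0
sumℤ {suc n} f = f zero ℤ.+ sumℤ (λ i → f (suc i))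

sumℚ : ∀ {n} → (Fin n → ℚ) → ℚ
sumℚ {zero}  f = 0ℚ
sumℚ {suc n} f = f zero ℚ.+ sumℚ (λ i → f (suc i))

sign : ℕ → ℤ
sign zero          = + 1
sign (suc zero)    = ℤ.- (+ 1)
sign (suc (suc k)) = sign k

det : ∀ {n} → Mat ℤ n → ℤ
det {zero}  M = + 1
det {suc n} M =
  sumℤ (λ j → sign (toℕ j) ℤ.* (M zero j ℤ.* det (λ i k → M (suc i) (punchIn j k))))

IsHNF : ∀ {n} → Mat ℤ n → Set
IsHNF {n} H =
  ((i j : Fin n) → i < j → H i j ≡ + 0) ×
  (((i : Fin n) → + 0 ℤ.< H i i) ×
   ((i j : Fin n) → j < i → (+ 0 ℤ.≤ H i j) × (H i j ℤ.< H i i)))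

toℚMat : ∀ {n} → Mat ℤ n → Mat ℚ n
toℚMat H i j = H i j ℚ./ 1

_·_ : ∀ {n} → Mat ℚ n → Mat ℚ n → Mat ℚ n
(A · B) i j = sumℚ (λ k → A i k ℚ.* B k j)

idℚ : ∀ {n} → Mat ℚ n
idℚ i j with i Fin.≟ j
... | yes _ = 1ℚ
... | no  _ = 0ℚ

IsInverse : ∀ {n} → Mat ℤ n → Mat ℚ n → Set
IsInverse H G = ((toℚMat H · G) ≡ idℚ) × ((G · toℚMat H) ≡ idℚ)

nnzCol : ∀ {n} → Mat ℚ n → Fin n → ℕ
nnzCol {n} G j = length (filter (λ i → ¬? (G i j ≟ 0ℚ)) (allFin n))

_^ℚ_ : ℚ → ℕ → ℚ
x ^ℚ zero  = 1ℚ
x ^ℚ suc k = x ℚ.* (x ^ℚ k)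

-- Real-free encoding of  r ≤ Δ^(log₂ Δ - 1) · c  for r ≥ 0 rational,
-- Δ ≥ 2 and c > 0: for every rational exponent u = p/m > log₂ Δ
-- (i.e. Δ^m < 2^p), r ≤ Δ^(u-1) · c, i.e. (r·Δ)^m ≤ c^m · Δ^p.
-- (Equivalent by monotonicity and continuity of u ↦ Δ^u.)
BoundByΔPowLog : ℕ → ℕ → ℚ → Set
BoundByΔPowLog Δ c r =
  (p m : ℕ) → 0 ℕ.< m → Δ ℕ.^ m ℕ.< 2 ℕ.^ p →
  ((r ℚ.* (+ Δ ℚ./ 1)) ^ℚ m) ℚ.≤ (((+ c ℚ./ 1) ^ℚ m) ℚ.* ((+ Δ ℚ./ 1) ^ℚ p))

{-# OPTIONS --safe #-}
module Submission where

-- Lower triangularity makes det H the product of the diagonal, so the q diagonal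
-- entries exceeding 1 give 2^q ≤ det H ≤ Δ, which is (a).  In an HNF the entries
-- left of the diagonal are reduced modulo the diagonal entry, so a row with
-- diagonal entry 1 is a unit row; hence the first n − q equations of H x = e_j
-- read x_i = δ_ij, which is (b).  Forward substitution for H x = e_j divides by
-- one diagonal entry per row, which is (c).  Since moreover 0 ≤ h_ik ≤ h_ii − 1,
-- the total absolute value of the right-hand side and the unknowns found so far
-- does not grow at a unit row and at most doubles at any other row, so
-- |h'_ij| ≤ 2^(q−1) ≤ Δ^(q−1) ≤ Δ^(log₂ Δ − 1), which is (d).

open import Data.Bool using (true; false)
open import Data.Empty using (⊥-elim)
open import Data.Fin as Fin using (Fin; zero; suc; toℕ)
import Data.Fin.Properties as Finₚ
open import Data.Integer as ℤ using (ℤ; +_)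
import Data.Integer.Properties as ℤₚ
open import Data.List using (_∷_; length; filter; tabulate)
import Data.List.Properties as Listₚ
open import Data.Nat as ℕ using (ℕ; zero; suc; _∸_; _^_; _!; z≤n; s≤s)
import Data.Nat.Properties as ℕₚ
open import Data.Nat.Logarithm using (⌊log₂_⌋; ⌈log₂_⌉; ⌊log₂⌋-mono-≤; ⌊log₂[2^n]⌋≡n)
open import Data.Product using (_×_; _,_; ∃; proj₁; proj₂)
open import Data.Rational as ℚ using (ℚ; 0ℚ; 1ℚ)
open import Data.Rational.Literals using (fromℤ)
import Data.Rational.Properties as ℚₚ
open import Data.Rational.Solver using (module +-*-Solver)
open import Function using (_∘_; id)
open import Relation.Binary.Definitions using (tri<; tri≈; tri>)
open import Relation.Binary.PropositionalEquality
  using (_≡_; _≢_; refl; sym; trans; cong; cong₂; subst; subst₂; module ≡-Reasoning)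
open import Relation.Nullary using (¬_; yes; no; does)
open import Relation.Nullary.Decidable using (¬?)
open import Relation.Unary using (Pred; Decidable)

open import Defs

trailing : ∀ {n} → Mat ℤ (suc n) → Mat ℤ n
trailing H i k = H (suc i) (suc k)

IsLowerTriangular : ∀ {n} → Mat ℤ n → Set
IsLowerTriangular {n} H = (i j : Fin n) → i Fin.< j → H i j ≡ + 0

trailing-lowerTriangular : ∀ {n} {H : Mat ℤ (suc n)} →
  IsLowerTriangular H → IsLowerTriangular (trailing H)
trailing-lowerTriangular low i j i<j = low (suc i) (suc j) (s≤s i<j)

trailing-HNF : ∀ {n} {H : Mat ℤ (suc n)} → IsHNF H → IsHNF (trailing H)
trailing-HNF (low , pos , reduced) =
  trailing-lowerTriangular low , pos ∘ suc , λ i j j<i → reduced (suc i) (suc j) (s≤s j<i)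

diagProd : ∀ {n} → Mat ℤ n → ℤ
diagProd {zero}  H = + 1
diagProd {suc n} H = H zero zero ℤ.* diagProd (trailing H)

sumℤ-zero : ∀ {n} {f : Fin n → ℤ} → (∀ k → f k ≡ + 0) → sumℤ f ≡ + 0
sumℤ-zero {zero}  _   = refl
sumℤ-zero {suc n} f≡0 = cong₂ ℤ._+_ (f≡0 zero) (sumℤ-zero (f≡0 ∘ suc))

det-lowerTriangular : ∀ {n} {H : Mat ℤ n} → IsLowerTriangular H → det H ≡ diagProd H
det-lowerTriangular {zero}      _   = refl
det-lowerTriangular {suc n} {H} low = begin
  det H
    ≡⟨ cong₂ ℤ._+_ (ℤₚ.*-identityˡ (h ℤ.* det (trailing H))) (sumℤ-zero first-row-vanishes) ⟩
  h ℤ.* det (trailing H) ℤ.+ + 0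
    ≡⟨ ℤₚ.+-identityʳ _ ⟩
  h ℤ.* det (trailing H)
    ≡⟨ cong (h ℤ.*_) (det-lowerTriangular (trailing-lowerTriangular low)) ⟩
  diagProd H
    ∎
  where
  open ≡-Reasoning
  h = H zero zero
  minor : Fin n → Mat ℤ n
  minor k i l = H (suc i) (Fin.punchIn (suc k) l)
  first-row-vanishes : ∀ k → sign (toℕ (suc k)) ℤ.* (H zero (suc k) ℤ.* det (minor k)) ≡ + 0
  first-row-vanishes k =
    trans (cong (λ c → sign (toℕ (suc k)) ℤ.* (c ℤ.* det (minor k))) (low zero (suc k) (s≤s z≤n)))
          (ℤₚ.*-zeroʳ (sign (toℕ (suc k))))

unitRow : ∀ {n} {H : Mat ℤ n} → IsHNF H → ∀ {i} → H i i ≡ + 1 → ∀ k → k ≢ i → H i k ≡ + 0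
unitRow {H = H} (low , _ , reduced) {i} Hii≡1 k k≢i with Finₚ.<-cmp i k
... | tri< i<k _ _ = low i k i<k
... | tri≈ _ i≡k _ = ⊥-elim (k≢i (sym i≡k))
... | tri> _ _ k<i with reduced i k k<i
...   | 0≤Hik , Hik<Hii =
  ℤₚ.≤-antisym (ℤₚ.i<j⇒i≤pred[j] (subst (H i k ℤ.<_) Hii≡1 Hik<Hii)) 0≤Hik

module _ where
  open import Data.Rational using (_+_; _*_; _-_; -_; _≤_; ∣_∣)
  open ℚₚ.≤-Reasoning
  open +-*-Solver

  /1≡fromℤ : ∀ z → z ℚ./ 1 ≡ fromℤ z
  /1≡fromℤ z = ℚₚ.↥p/↧p≡p (fromℤ z)

  fromℤ-+ : ∀ a b → fromℤ (a ℤ.+ b) ≡ fromℤ a + fromℤ b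
  fromℤ-+ a b = sym (trans
    (cong₂ (λ u v → (u ℤ.+ v) ℚ./ 1) (ℤₚ.*-identityʳ a) (ℤₚ.*-identityʳ b)) (/1≡fromℤ (a ℤ.+ b)))

  fromℤ-* : ∀ a b → fromℤ (a ℤ.* b) ≡ fromℤ a * fromℤ b
  fromℤ-* a b = sym (/1≡fromℤ (a ℤ.* b))

  fromℤ-pos-* : ∀ m n → fromℤ (+ (m ℕ.* n)) ≡ fromℤ (+ m) * fromℤ (+ n)
  fromℤ-pos-* m n = trans (cong fromℤ (ℤₚ.pos-* m n)) (fromℤ-* (+ m) (+ n))

  fromℤ-neg : ∀ a → fromℤ (ℤ.- a) ≡ - fromℤ a
  fromℤ-neg (+ zero)   = refl
  fromℤ-neg (+ suc _)  = refl
  fromℤ-neg ℤ.-[1+ _ ] = refl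

  fromℤ-minus : ∀ a b → fromℤ (a ℤ.- b) ≡ fromℤ a - fromℤ b
  fromℤ-minus a b = trans (fromℤ-+ a (ℤ.- b)) (cong (_+_ (fromℤ a)) (fromℤ-neg b))

  fromℤ-pred : ∀ a → fromℤ (ℤ.pred a) ≡ fromℤ a - 1ℚ
  fromℤ-pred a = trans (fromℤ-+ ℤ.-1ℤ a) (ℚₚ.+-comm (fromℤ ℤ.-1ℤ) (fromℤ a))

  fromℤ-mono-≤ : ∀ {a b} → a ℤ.≤ b → fromℤ a ≤ fromℤ b
  fromℤ-mono-≤ {a} {b} a≤b =
    ℚ.*≤* (subst₂ ℤ._≤_ (sym (ℤₚ.*-identityʳ a)) (sym (ℤₚ.*-identityʳ b)) a≤b)

  0≤fromℤ-pos : ∀ m → 0ℚ ≤ fromℤ (+ m)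
  0≤fromℤ-pos m = fromℤ-mono-≤ (ℤ.+≤+ z≤n)

  1≤fromℤ : ∀ {a} → + 0 ℤ.< a → 1ℚ ≤ fromℤ a
  1≤fromℤ 0<a = fromℤ-mono-≤ (ℤₚ.i<j⇒suc[i]≤j 0<a)

  p≤p+q : ∀ {p q} → 0ℚ ≤ q → p ≤ p + q
  p≤p+q {p} {q} 0≤q = subst (_≤ p + q) (ℚₚ.+-identityʳ p) (ℚₚ.+-monoʳ-≤ p 0≤q)

  p≤q+p : ∀ {p q} → 0ℚ ≤ q → p ≤ q + p
  p≤q+p {p} {q} 0≤q = subst (_≤ q + p) (ℚₚ.+-identityˡ p) (ℚₚ.+-monoˡ-≤ p 0≤q)

  *-monoˡ-≤-0≤ : ∀ {r p q} → 0ℚ ≤ r → p ≤ q → r * p ≤ r * q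
  *-monoˡ-≤-0≤ {r} 0≤r = ℚₚ.*-monoˡ-≤-nonNeg r {{ℚ.nonNegative 0≤r}}

  *-monoʳ-≤-0≤ : ∀ {r p q} → 0ℚ ≤ r → p ≤ q → p * r ≤ q * r
  *-monoʳ-≤-0≤ {r} 0≤r = ℚₚ.*-monoʳ-≤-nonNeg r {{ℚ.nonNegative 0≤r}}

  0≤p*q : ∀ {p q} → 0ℚ ≤ p → 0ℚ ≤ q → 0ℚ ≤ p * q
  0≤p*q {p} 0≤p 0≤q = subst (_≤ p * _) (ℚₚ.*-zeroʳ p) (*-monoˡ-≤-0≤ 0≤p 0≤q)

  ∣p*q∣≡p*∣q∣ : ∀ {p} q → 0ℚ ≤ p → ∣ p * q ∣ ≡ p * ∣ q ∣
  ∣p*q∣≡p*∣q∣ {p} q 0≤p =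
    trans (ℚₚ.∣p*q∣≡∣p∣*∣q∣ p q) (cong (_* ∣ q ∣) (ℚₚ.0≤p⇒∣p∣≡p 0≤p))

  ^ℚ-nonNeg : ∀ {a} m → 0ℚ ≤ a → 0ℚ ≤ a ^ℚ m
  ^ℚ-nonNeg zero    _   = 0≤fromℤ-pos 1
  ^ℚ-nonNeg (suc m) 0≤a = 0≤p*q 0≤a (^ℚ-nonNeg m 0≤a)

  ^ℚ-mono-≤ : ∀ {a b} m → 0ℚ ≤ a → a ≤ b → a ^ℚ m ≤ b ^ℚ m
  ^ℚ-mono-≤         zero    _   _   = ℚₚ.≤-refl
  ^ℚ-mono-≤ {a} {b} (suc m) 0≤a a≤b = begin
    a * a ^ℚ m    ≤⟨ *-monoʳ-≤-0≤ (^ℚ-nonNeg m 0≤a) a≤b ⟩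
    b * a ^ℚ m    ≤⟨ *-monoˡ-≤-0≤ (ℚₚ.≤-trans 0≤a a≤b) (^ℚ-mono-≤ m 0≤a a≤b) ⟩
    b * b ^ℚ m    ∎

  fromℤ-^ℚ : ∀ a m → fromℤ (+ a) ^ℚ m ≡ fromℤ (+ (a ^ m))
  fromℤ-^ℚ a zero    = refl
  fromℤ-^ℚ a (suc m) = trans (cong (fromℤ (+ a) *_) (fromℤ-^ℚ a m)) (sym (fromℤ-pos-* a (a ^ m)))

  sumℚ-cong : ∀ {n} {f g : Fin n → ℚ} → (∀ k → f k ≡ g k) → sumℚ f ≡ sumℚ g
  sumℚ-cong {zero}  _   = refl
  sumℚ-cong {suc n} f≡g = cong₂ _+_ (f≡g zero) (sumℚ-cong (f≡g ∘ suc))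

  sumℚ-zero : ∀ {n} {f : Fin n → ℚ} → (∀ k → f k ≡ 0ℚ) → sumℚ f ≡ 0ℚ
  sumℚ-zero {zero}  _   = refl
  sumℚ-zero {suc n} f≡0 = cong₂ _+_ (f≡0 zero) (sumℚ-zero (f≡0 ∘ suc))

  sumℚ-single : ∀ {n} {f : Fin n → ℚ} i → (∀ k → k ≢ i → f k ≡ 0ℚ) → sumℚ f ≡ f i
  sumℚ-single {suc n} {f} zero    f≡0 =
    trans (cong (_+_ (f zero)) (sumℚ-zero λ k → f≡0 (suc k) λ ())) (ℚₚ.+-identityʳ (f zero))
  sumℚ-single {suc n} {f} (suc i) f≡0 =
    trans (cong₂ _+_ (f≡0 zero λ ()) (sumℚ-single i λ k k≢i → f≡0 (suc k) (k≢i ∘ Finₚ.suc-injective)))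
          (ℚₚ.+-identityˡ (f (suc i)))

  *-distribˡ-sumℚ : ∀ {n} a (f : Fin n → ℚ) → a * sumℚ f ≡ sumℚ (λ k → a * f k)
  *-distribˡ-sumℚ {zero}  a f = ℚₚ.*-zeroʳ a
  *-distribˡ-sumℚ {suc n} a f =
    trans (ℚₚ.*-distribˡ-+ a (f zero) _) (cong (_+_ (a * f zero)) (*-distribˡ-sumℚ a (f ∘ suc)))

  sumℚ-nonNeg : ∀ {n} {f : Fin n → ℚ} → (∀ k → 0ℚ ≤ f k) → 0ℚ ≤ sumℚ f
  sumℚ-nonNeg {zero}  _   = ℚₚ.≤-refl
  sumℚ-nonNeg {suc n} 0≤f = ℚₚ.+-mono-≤ (0≤f zero) (sumℚ-nonNeg (0≤f ∘ suc))

  idℚ-diag : ∀ {n} (j : Fin n) → idℚ j j ≡ 1ℚ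
  idℚ-diag j with j Fin.≟ j
  ... | yes _   = refl
  ... | no j≢j = ⊥-elim (j≢j refl)

  idℚ-off : ∀ {n} {i j : Fin n} → i ≢ j → idℚ i j ≡ 0ℚ
  idℚ-off {i = i} {j} i≢j with i Fin.≟ j
  ... | yes i≡j = ⊥-elim (i≢j i≡j)
  ... | no _    = refl

  sumℚ-∣idℚ∣ : ∀ {n} (j : Fin n) → sumℚ (λ i → ∣ idℚ i j ∣) ≡ 1ℚ
  sumℚ-∣idℚ∣ j = trans (sumℚ-single j λ k k≢j → cong ∣_∣ (idℚ-off k≢j)) (cong ∣_∣ (idℚ-diag j))

  record Solves {n} (H : Mat ℤ n) (x b : Fin n → ℚ) : Set where
    field
      equation : ∀ i → sumℚ (λ k → fromℤ (H i k) * x k) ≡ b i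

  open Solves

  inverse-solves : ∀ {n} {H : Mat ℤ n} {G} → IsInverse H G →
    ∀ j → Solves H (λ k → G k j) (λ i → idℚ i j)
  inverse-solves {H = H} {G} (HG≡I , _) j .equation i =
    trans (sumℚ-cong λ k → cong (_* G k j) (sym (/1≡fromℤ (H i k)))) (cong (λ M → M i j) HG≡I)

  solves-head : ∀ {n} {H : Mat ℤ (suc n)} {x b} →
    IsLowerTriangular H → Solves H x b → fromℤ (H zero zero) * x zero ≡ b zero
  solves-head {H = H} {x} low sol = begin-equality
    fromℤ (H zero zero) * x zero
      ≡⟨ sym (ℚₚ.+-identityʳ _) ⟩
    fromℤ (H zero zero) * x zero + 0ℚ
      ≡⟨ cong (_+_ (fromℤ (H zero zero) * x zero)) (sym (sumℚ-zero right-of-diagonal)) ⟩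
    sumℚ (λ k → fromℤ (H zero k) * x k)
      ≡⟨ equation sol zero ⟩
    _
      ∎
    where
    right-of-diagonal : ∀ k → fromℤ (H zero (suc k)) * x (suc k) ≡ 0ℚ
    right-of-diagonal k =
      trans (cong (λ c → fromℤ c * x (suc k)) (low zero (suc k) (s≤s z≤n))) (ℚₚ.*-zeroˡ (x (suc k)))

  solves-trailing : ∀ {n} {H : Mat ℤ (suc n)} {x b} → Solves H x b →
    Solves (trailing H) (x ∘ suc) (λ i → b (suc i) - fromℤ (H (suc i) zero) * x zero)
  solves-trailing {H = H} {x} sol .equation i =
    trans (solve 2 (λ a s → s := a :+ s :- a) refl (fromℤ (H (suc i) zero) * x zero) _)
          (cong (_- _) (equation sol (suc i)))

  solves-*ˡ : ∀ {n} {H : Mat ℤ n} {x b} a → Solves H x b →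
    Solves H (λ k → a * x k) (λ i → a * b i)
  solves-*ˡ {H = H} {x} a sol .equation i = begin-equality
    sumℚ (λ k → fromℤ (H i k) * (a * x k))
      ≡⟨ sumℚ-cong (λ k → solve 3 (λ h a y → h :* (a :* y) := a :* (h :* y)) refl (fromℤ (H i k)) a (x k)) ⟩
    sumℚ (λ k → a * (fromℤ (H i k) * x k))
      ≡⟨ sym (*-distribˡ-sumℚ a (λ k → fromℤ (H i k) * x k)) ⟩
    a * sumℚ (λ k → fromℤ (H i k) * x k)
      ≡⟨ cong (a *_) (equation sol i) ⟩
    _
      ∎

  solves-unitRow : ∀ {n} {H : Mat ℤ n} {x b} → IsHNF H → ∀ {i} → H i i ≡ + 1 →
    Solves H x b → x i ≡ b i
  solves-unitRow {H = H} {x} {b} hnf {i} Hii≡1 sol = begin-equality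
    x i                                   ≡⟨ sym (ℚₚ.*-identityˡ (x i)) ⟩
    fromℤ (+ 1) * x i                     ≡⟨ cong (λ h → fromℤ h * x i) (sym Hii≡1) ⟩
    fromℤ (H i i) * x i                   ≡⟨ sym (sumℚ-single i off-diagonal) ⟩
    sumℚ (λ k → fromℤ (H i k) * x k)      ≡⟨ equation sol i ⟩
    b i                                   ∎
    where
    off-diagonal : ∀ k → k ≢ i → fromℤ (H i k) * x k ≡ 0ℚ
    off-diagonal k k≢i =
      trans (cong (λ c → fromℤ c * x k) (unitRow hnf Hii≡1 k k≢i)) (ℚₚ.*-zeroˡ (x k))

  IsInt : ℚ → Set
  IsInt p = ∃ λ z → p ≡ fromℤ z

  isInt-* : ∀ {p q} → IsInt p → IsInt q → IsInt (p * q)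
  isInt-* (a , refl) (b , refl) = a ℤ.* b , sym (fromℤ-* a b)

  isInt-minus : ∀ {p q} → IsInt p → IsInt q → IsInt (p - q)
  isInt-minus (a , refl) (b , refl) = a ℤ.- b , sym (fromℤ-minus a b)

  idℚ-isInt : ∀ {n} (i j : Fin n) → IsInt (idℚ i j)
  idℚ-isInt i j with i Fin.≟ j
  ... | yes _ = + 1 , refl
  ... | no _  = + 0 , refl

  -- Scaling the trailing system by h = H₀₀ keeps its right-hand side integral,
  -- because h x₀ = b₀.
  diagProd*solution-isInt : ∀ {n} {H : Mat ℤ n} {x b} → IsLowerTriangular H → Solves H x b →
    (∀ i → IsInt (b i)) → ∀ i → IsInt (fromℤ (diagProd H) * x i)
  diagProd*solution-isInt {suc n} {H} {x} {b} low sol b-int i =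
    subst IsInt (sym (regroup i)) (scaled i)
    where
    h = fromℤ (H zero zero)
    d = fromℤ (diagProd (trailing H))
    regroup : ∀ i → fromℤ (diagProd H) * x i ≡ d * (h * x i)
    regroup i = trans (cong (_* x i) (fromℤ-* (H zero zero) _))
                      (solve 3 (λ h d y → (h :* d) :* y := d :* (h :* y)) refl h d (x i))
    scaled-rhs-isInt : ∀ i → IsInt (h * (b (suc i) - fromℤ (H (suc i) zero) * x zero))
    scaled-rhs-isInt i = subst IsInt (sym expand)
      (isInt-minus (isInt-* (H zero zero , refl) (b-int (suc i))) (isInt-* (H (suc i) zero , refl) (b-int zero)))
      where
      c = fromℤ (H (suc i) zero)
      expand : h * (b (suc i) - c * x zero) ≡ h * b (suc i) - c * b zero
      expand = trans
        (solve 4 (λ h b c y → h :* (b :- c :* y) := h :* b :- c :* (h :* y)) refl h (b (suc i)) c (x zero))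
        (cong (λ t → h * b (suc i) - c * t) (solves-head low sol))
    scaled : ∀ i → IsInt (d * (h * x i))
    scaled zero    = subst (λ t → IsInt (d * t)) (sym (solves-head low sol))
                           (isInt-* (diagProd (trailing H) , refl) (b-int zero))
    scaled (suc i) = diagProd*solution-isInt (trailing-lowerTriangular low)
                       (solves-*ˡ h (solves-trailing sol)) scaled-rhs-isInt i

  -- The invariant of forward substitution: rhs is a right-hand side bounded
  -- entrywise by A after substituting unknowns of total absolute value β; since
  -- each substituted HNF coefficient lies in [0, H i i − 1], this gives ∣rhs∣≤.
  record BoundedSolution {n} (H : Mat ℤ n) (x : Fin n → ℚ) (U : ℚ) : Set where
    field
      rhs     : Fin n → ℚ
      solves  : Solves H x rhs
      A       : Fin n → ℚ
      β       : ℚ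
      0≤A     : ∀ i → 0ℚ ≤ A i
      0≤β     : 0ℚ ≤ β
      ∣rhs∣≤  : ∀ i → ∣ rhs i ∣ ≤ A i + (fromℤ (H i i) - 1ℚ) * β
      total≤U : sumℚ A + β ≤ U

  boundedSolution : ∀ {n} {H : Mat ℤ n} {x b U} → Solves H x b → sumℚ (λ i → ∣ b i ∣) ≤ U →
    BoundedSolution H x U
  boundedSolution {H = H} {b = b} {U} sol total≤U = record
    { rhs     = b
    ; solves  = sol
    ; A       = λ i → ∣ b i ∣
    ; β       = 0ℚ
    ; 0≤A     = λ i → ℚₚ.0≤∣p∣ (b i)
    ; 0≤β     = ℚₚ.≤-refl
    ; ∣rhs∣≤  = λ i → ℚₚ.≤-reflexive (sym (no-carry i))
    ; total≤U = subst (_≤ U) (sym (ℚₚ.+-identityʳ _)) total≤U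
    }
    where
    no-carry : ∀ i → ∣ b i ∣ + (fromℤ (H i i) - 1ℚ) * 0ℚ ≡ ∣ b i ∣
    no-carry i = trans (cong (_+_ ∣ b i ∣) (ℚₚ.*-zeroʳ (fromℤ (H i i) - 1ℚ))) (ℚₚ.+-identityʳ ∣ b i ∣)

  h*y≤a+[h-1]β⇒y≤a+β : ∀ {h y a β} → 1ℚ ≤ h → 0ℚ ≤ a → 0ℚ ≤ β →
    h * y ≤ a + (h - 1ℚ) * β → y ≤ a + β
  h*y≤a+[h-1]β⇒y≤a+β {h} {y} {a} {β} 1≤h 0≤a 0≤β hy≤ =
    ℚₚ.*-cancelˡ-≤-pos h {{ℚ.positive (ℚₚ.<-≤-trans (ℚₚ.positive⁻¹ 1ℚ) 1≤h)}} (begin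
      h * y
        ≤⟨ hy≤ ⟩
      a + (h - 1ℚ) * β
        ≤⟨ p≤p+q (ℚₚ.+-mono-≤ (0≤p*q 0≤h-1 0≤a) 0≤β) ⟩
      a + (h - 1ℚ) * β + ((h - 1ℚ) * a + β)
        ≡⟨ solve 3 (λ h a β → a :+ (h :- con 1ℚ) :* β :+ ((h :- con 1ℚ) :* a :+ β) := h :* (a :+ β))
                   refl h a β ⟩
      h * (a + β)
        ∎)
    where
    0≤h-1 : 0ℚ ≤ h - 1ℚ
    0≤h-1 = subst (_≤ h - 1ℚ) (ℚₚ.+-inverseʳ 1ℚ) (ℚₚ.+-monoˡ-≤ (- 1ℚ) 1≤h)

  module _ {n} {H : Mat ℤ (suc n)} {x : Fin (suc n) → ℚ} {U}
           (hnf : IsHNF H) (s : BoundedSolution H x U) where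
    open BoundedSolution s

    private
      S′ = sumℚ (A ∘ suc)

      0≤S′ : 0ℚ ≤ S′
      0≤S′ = sumℚ-nonNeg (0≤A ∘ suc)

    ∣head∣≤A₀+β : ∣ x zero ∣ ≤ A zero + β
    ∣head∣≤A₀+β = h*y≤a+[h-1]β⇒y≤a+β (1≤fromℤ (pos zero)) (0≤A zero) 0≤β (begin
      fromℤ (H zero zero) * ∣ x zero ∣    ≡⟨ sym (∣p*q∣≡p*∣q∣ (x zero) (fromℤ-mono-≤ (ℤₚ.<⇒≤ (pos zero)))) ⟩
      ∣ fromℤ (H zero zero) * x zero ∣    ≡⟨ cong ∣_∣ (solves-head (proj₁ hnf) solves) ⟩
      ∣ rhs zero ∣                        ≤⟨ ∣rhs∣≤ zero ⟩
      A zero + (fromℤ (H zero zero) - 1ℚ) * β ∎)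
      where pos = proj₁ (proj₂ hnf)

    ∣head∣≤U : ∣ x zero ∣ ≤ U
    ∣head∣≤U = begin
      ∣ x zero ∣          ≤⟨ ∣head∣≤A₀+β ⟩
      A zero + β          ≤⟨ ℚₚ.+-monoˡ-≤ β (p≤p+q {A zero} 0≤S′) ⟩
      A zero + S′ + β     ≤⟨ total≤U ⟩
      U                   ∎

    total-unit : H zero zero ≡ + 1 → S′ + (β + ∣ x zero ∣) ≤ U
    total-unit H₀₀≡1 = begin
      S′ + (β + ∣ x zero ∣)   ≤⟨ ℚₚ.+-monoʳ-≤ S′ (ℚₚ.+-monoʳ-≤ β ∣head∣≤A₀) ⟩
      S′ + (β + A zero)       ≡⟨ solve 3 (λ s b a → s :+ (b :+ a) := a :+ s :+ b) refl S′ β (A zero) ⟩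
      A zero + S′ + β         ≤⟨ total≤U ⟩
      U                       ∎
      where
      ∣head∣≤A₀ : ∣ x zero ∣ ≤ A zero
      ∣head∣≤A₀ = begin
        ∣ x zero ∣
          ≡⟨ cong ∣_∣ (solves-unitRow hnf H₀₀≡1 solves) ⟩
        ∣ rhs zero ∣
          ≤⟨ ∣rhs∣≤ zero ⟩
        A zero + (fromℤ (H zero zero) - 1ℚ) * β
          ≡⟨ cong (λ h → A zero + (fromℤ h - 1ℚ) * β) H₀₀≡1 ⟩
        A zero + 0ℚ * β
          ≡⟨ trans (cong (_+_ (A zero)) (ℚₚ.*-zeroˡ β)) (ℚₚ.+-identityʳ (A zero)) ⟩
        A zero
          ∎

    total-double : S′ + (β + ∣ x zero ∣) ≤ U + U
    total-double = begin
      S′ + (β + ∣ x zero ∣)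
        ≤⟨ ℚₚ.+-monoʳ-≤ S′ (ℚₚ.+-monoʳ-≤ β ∣head∣≤A₀+β) ⟩
      S′ + (β + (A zero + β))
        ≡⟨ solve 3 (λ s b a → s :+ (b :+ (a :+ b)) := a :+ s :+ b :+ b) refl S′ β (A zero) ⟩
      A zero + S′ + β + β
        ≤⟨ ℚₚ.+-mono-≤ total≤U β≤U ⟩
      U + U
        ∎
      where
      β≤U : β ≤ U
      β≤U = ℚₚ.≤-trans (p≤q+p (ℚₚ.+-mono-≤ (0≤A zero) 0≤S′)) total≤U

    trailing-bounded : ∀ {V} → S′ + (β + ∣ x zero ∣) ≤ V → BoundedSolution (trailing H) (x ∘ suc) V
    trailing-bounded total≤V = record
      { rhs     = λ i → rhs (suc i) - fromℤ (H (suc i) zero) * x zero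
      ; solves  = solves-trailing solves
      ; A       = A ∘ suc
      ; β       = β + ∣ x zero ∣
      ; 0≤A     = 0≤A ∘ suc
      ; 0≤β     = ℚₚ.+-mono-≤ 0≤β (ℚₚ.0≤∣p∣ (x zero))
      ; ∣rhs∣≤  = ∣rhs′∣≤
      ; total≤U = total≤V
      }
      where
      ∣rhs′∣≤ : ∀ i → ∣ rhs (suc i) - fromℤ (H (suc i) zero) * x zero ∣
                      ≤ A (suc i) + (fromℤ (H (suc i) (suc i)) - 1ℚ) * (β + ∣ x zero ∣)
      ∣rhs′∣≤ i = begin
        ∣ rhs (suc i) - c * x zero ∣
          ≤⟨ ℚₚ.∣p-q∣≤∣p∣+∣q∣ (rhs (suc i)) (c * x zero) ⟩
        ∣ rhs (suc i) ∣ + ∣ c * x zero ∣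
          ≡⟨ cong (_+_ ∣ rhs (suc i) ∣) (∣p*q∣≡p*∣q∣ (x zero) 0≤c) ⟩
        ∣ rhs (suc i) ∣ + c * ∣ x zero ∣
          ≤⟨ ℚₚ.+-mono-≤ (∣rhs∣≤ (suc i)) (*-monoʳ-≤-0≤ (ℚₚ.0≤∣p∣ (x zero)) c≤h-1) ⟩
        A (suc i) + (h - 1ℚ) * β + (h - 1ℚ) * ∣ x zero ∣
          ≡⟨ solve 4 (λ a m b y → a :+ m :* b :+ m :* y := a :+ m :* (b :+ y))
                     refl (A (suc i)) (h - 1ℚ) β ∣ x zero ∣ ⟩
        A (suc i) + (h - 1ℚ) * (β + ∣ x zero ∣)
          ∎
        where
        c = fromℤ (H (suc i) zero)
        h = fromℤ (H (suc i) (suc i))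
        reduced = proj₂ (proj₂ hnf) (suc i) zero (s≤s z≤n)
        0≤c : 0ℚ ≤ c
        0≤c = fromℤ-mono-≤ (proj₁ reduced)
        c≤h-1 : c ≤ h - 1ℚ
        c≤h-1 = subst (c ≤_) (fromℤ-pred (H (suc i) (suc i)))
                      (fromℤ-mono-≤ (ℤₚ.i<j⇒i≤pred[j] (proj₂ reduced)))

  ≤*2^ : ∀ {a U} k → 0ℚ ≤ U → a ≤ U → a ≤ U * fromℤ (+ (2 ^ k))
  ≤*2^ {a} {U} k 0≤U a≤U = begin
    a                         ≤⟨ a≤U ⟩
    U                         ≡⟨ sym (ℚₚ.*-identityʳ U) ⟩
    U * 1ℚ                    ≤⟨ *-monoˡ-≤-0≤ 0≤U (fromℤ-mono-≤ (ℤ.+≤+ (ℕₚ.m^n>0 2 k))) ⟩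
    U * fromℤ (+ (2 ^ k))     ∎

  [U+U]*2^k≡U*2^[1+k] : ∀ U k → (U + U) * fromℤ (+ (2 ^ k)) ≡ U * fromℤ (+ (2 ^ suc k))
  [U+U]*2^k≡U*2^[1+k] U k = begin-equality
    (U + U) * t                        ≡⟨ solve 2 (λ U t → (U :+ U) :* t := U :* (con (fromℤ (+ 2)) :* t)) refl U t ⟩
    U * (fromℤ (+ 2) * t)              ≡⟨ cong (U *_) (sym (fromℤ-pos-* 2 (2 ^ k))) ⟩
    U * fromℤ (+ (2 ^ suc k))          ∎
    where t = fromℤ (+ (2 ^ k))

  solution-bound : ∀ {n} {H : Mat ℤ n} {x U} → IsHNF H →
    (p : ℕ) → (∀ i → toℕ i ℕ.< p → H i i ≡ + 1) →
    BoundedSolution H x U → ∀ i → ∣ x i ∣ ≤ U * fromℤ (+ (2 ^ (toℕ i ∸ p)))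
  solution-bound hnf p _ s zero =
    ≤*2^ (0 ∸ p) (ℚₚ.≤-trans (ℚₚ.0≤∣p∣ _) (∣head∣≤U hnf s)) (∣head∣≤U hnf s)
  solution-bound {U = U} hnf zero _ s (suc i) = ℚₚ.≤-trans
    (solution-bound (trailing-HNF hnf) zero (λ _ ()) (trailing-bounded hnf s (total-double hnf s)) i)
    (ℚₚ.≤-reflexive ([U+U]*2^k≡U*2^[1+k] U (toℕ i)))
  solution-bound hnf (suc p) unit s (suc i) =
    solution-bound (trailing-HNF hnf) p (λ i i<p → unit (suc i) (s≤s i<p))
      (trailing-bounded hnf s (total-unit hnf s (unit zero (s≤s z≤n)))) i

open import Data.Nat using (_≤_; _<_; _*_)

2^[n∸p]≤diagProd : ∀ {n} (H : Mat ℤ n) p →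
  (∀ i → + 0 ℤ.< H i i) → (∀ i → p ≤ toℕ i → + 1 ℤ.< H i i) → + (2 ^ (n ∸ p)) ℤ.≤ diagProd H
2^[n∸p]≤diagProd {zero}  H zero    _   _   = ℤₚ.≤-refl
2^[n∸p]≤diagProd {zero}  H (suc p) _   _   = ℤₚ.≤-refl
2^[n∸p]≤diagProd {suc n} H zero    pos big = begin
  + (2 * 2 ^ n)                ≡⟨ ℤₚ.pos-* 2 (2 ^ n) ⟩
  + 2 ℤ.* + (2 ^ n)            ≤⟨ ℤₚ.*-monoʳ-≤-nonNeg (+ (2 ^ n)) (ℤₚ.i<j⇒suc[i]≤j (big zero z≤n)) ⟩
  H zero zero ℤ.* + (2 ^ n)    ≤⟨ ℤₚ.*-monoˡ-≤-nonNeg (H zero zero) {{ℤ.nonNegative (ℤₚ.<⇒≤ (pos zero))}}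
                                    (2^[n∸p]≤diagProd (trailing H) zero (pos ∘ suc) λ i _ → big (suc i) z≤n) ⟩
  diagProd H                   ∎
  where open ℤₚ.≤-Reasoning
2^[n∸p]≤diagProd {suc n} H (suc p) pos big = begin
  + (2 ^ (n ∸ p))                    ≡⟨ sym (ℤₚ.*-identityˡ _) ⟩
  + 1 ℤ.* + (2 ^ (n ∸ p))            ≤⟨ ℤₚ.*-monoʳ-≤-nonNeg (+ (2 ^ (n ∸ p))) (ℤₚ.i<j⇒suc[i]≤j (pos zero)) ⟩
  H zero zero ℤ.* + (2 ^ (n ∸ p))    ≤⟨ ℤₚ.*-monoˡ-≤-nonNeg (H zero zero) {{ℤ.nonNegative (ℤₚ.<⇒≤ (pos zero))}}
                                          (2^[n∸p]≤diagProd (trailing H) p (pos ∘ suc) λ i p≤i → big (suc i) (s≤s p≤i)) ⟩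
  diagProd H                         ∎
  where open ℤₚ.≤-Reasoning

2^q≤det : ∀ {n q} {H : Mat ℤ n} → IsHNF H → q ≤ n → (∀ i → n ∸ q ≤ toℕ i → + 1 ℤ.< H i i) →
  + (2 ^ q) ℤ.≤ det H
2^q≤det {n} {q} {H} (low , pos , _) q≤n big = begin
  + (2 ^ q)                 ≡⟨ cong (λ e → + (2 ^ e)) (sym (ℕₚ.m∸[m∸n]≡n q≤n)) ⟩
  + (2 ^ (n ∸ (n ∸ q)))     ≤⟨ 2^[n∸p]≤diagProd H (n ∸ q) pos big ⟩
  diagProd H                ≡⟨ sym (det-lowerTriangular low) ⟩
  det H                     ∎
  where open ℤₚ.≤-Reasoning

module _ {a p} {A : Set a} {P : Pred A p} (P? : Decidable P) where

  length-filter-∷ : ∀ x xs → length (filter P? (x ∷ xs)) ≤ suc (length (filter P? xs))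
  length-filter-∷ x xs with does (P? x)
  ... | true  = ℕₚ.≤-refl
  ... | false = ℕₚ.n≤1+n _

  length-filter-tabulate : ∀ {n} (g : Fin n → A) → length (filter P? (tabulate g)) ≤ n
  length-filter-tabulate g = subst (length (filter P? (tabulate g)) ≤_)
    (Listₚ.length-tabulate g) (Listₚ.length-filter P? (tabulate g))

  length-filter-tabulate-skip : ∀ {n} (g : Fin n → A) m → (∀ i → toℕ i < m → ¬ P (g i)) →
    length (filter P? (tabulate g)) ≤ n ∸ m
  length-filter-tabulate-skip {zero}  g m       _  = z≤n
  length-filter-tabulate-skip {suc n} g zero    _  = length-filter-tabulate g
  length-filter-tabulate-skip {suc n} g (suc m) ¬P =
    ℕₚ.≤-trans (ℕₚ.≤-reflexive (cong length (Listₚ.filter-reject P? (¬P zero (s≤s z≤n)))))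
               (length-filter-tabulate-skip (g ∘ suc) m λ i i<m → ¬P (suc i) (s≤s i<m))

  length-filter-tabulate-except : ∀ {n} (g : Fin n → A) m j → (∀ i → toℕ i < m → P (g i) → i ≡ j) →
    length (filter P? (tabulate g)) ≤ suc (n ∸ m)
  length-filter-tabulate-except g zero j _ = ℕₚ.m≤n⇒m≤1+n (length-filter-tabulate g)
  length-filter-tabulate-except {suc n} g (suc m) zero only-j =
    ℕₚ.≤-trans (length-filter-∷ (g zero) (tabulate (g ∘ suc)))
      (s≤s (length-filter-tabulate-skip (g ∘ suc) m λ i i<m → Finₚ.0≢1+n ∘ sym ∘ only-j (suc i) (s≤s i<m)))
  length-filter-tabulate-except {suc n} g (suc m) (suc j) only-j =
    ℕₚ.≤-trans (ℕₚ.≤-reflexive (cong length (Listₚ.filter-reject P? (Finₚ.0≢1+n ∘ only-j zero (s≤s z≤n)))))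
      (length-filter-tabulate-except (g ∘ suc) m j λ i i<m → Finₚ.suc-injective ∘ only-j (suc i) (s≤s i<m))

nnzCol-inverse-≤ : ∀ {n p} {H : Mat ℤ n} {G} → IsHNF H → (∀ i → toℕ i < p → H i i ≡ + 1) →
  IsInverse H G → ∀ j → nnzCol G j ≤ suc (n ∸ p)
nnzCol-inverse-≤ {n} {p} {H} {G} hnf unit inverse j =
  length-filter-tabulate-except (λ i → ¬? (G i j ℚₚ.≟ 0ℚ)) id p j only-j
  where
  only-j : ∀ i → toℕ i < p → G i j ≢ 0ℚ → i ≡ j
  only-j i i<p Gij≢0 with i Fin.≟ j
  ... | yes i≡j = i≡j
  ... | no i≢j  =
    ⊥-elim (Gij≢0 (trans (solves-unitRow hnf (unit i i<p) (inverse-solves inverse j)) (idℚ-off i≢j)))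

det*inverse-isInt : ∀ {n} {H : Mat ℤ n} {G} → IsLowerTriangular H → IsInverse H G →
  ∀ i j → IsInt (fromℤ (det H) ℚ.* G i j)
det*inverse-isInt {H = H} {G} low inverse i j =
  subst (λ d → IsInt (fromℤ d ℚ.* G i j)) (sym (det-lowerTriangular low))
    (diagProd*solution-isInt low (inverse-solves inverse j) (λ k → idℚ-isInt k j) i)

∣inverse∣≤2^ : ∀ {n} {H : Mat ℤ n} {G} → IsHNF H → (p : ℕ) → (∀ i → toℕ i < p → H i i ≡ + 1) →
  IsInverse H G → ∀ i j → ℚ.∣ G i j ∣ ℚ.≤ fromℤ (+ (2 ^ (toℕ i ∸ p)))
∣inverse∣≤2^ {G = G} hnf p unit inverse i j =
  subst (ℚ.∣ G i j ∣ ℚ.≤_) (ℚₚ.*-identityˡ _)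
    (solution-bound hnf p unit
      (boundedSolution (inverse-solves inverse j) (ℚₚ.≤-reflexive (sumℚ-∣idℚ∣ j))) i)

2^k*b≤b^q : ∀ {k q b} → k < q → 2 ≤ b → 2 ^ k * b ≤ b ^ q
2^k*b≤b^q {k} {q} {b} k<q 2≤b = begin
  2 ^ k * b    ≤⟨ ℕₚ.*-monoˡ-≤ b (ℕₚ.^-monoˡ-≤ k 2≤b) ⟩
  b ^ k * b    ≡⟨ ℕₚ.*-comm (b ^ k) b ⟩
  b ^ suc k    ≤⟨ ℕₚ.^-monoʳ-≤ b {{ℕ.>-nonZero (ℕₚ.<-≤-trans (s≤s z≤n) 2≤b)}} k<q ⟩
  b ^ q        ∎
  where open ℕₚ.≤-Reasoning

2^q≤b⇒b^m<2^p⇒[b^q]^m≤b^p : ∀ {b} q m p → 2 ^ q ≤ b → b ^ m < 2 ^ p → (b ^ q) ^ m ≤ b ^ p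
2^q≤b⇒b^m<2^p⇒[b^q]^m≤b^p {b} q m p 2^q≤b b^m<2^p = begin
  (b ^ q) ^ m    ≡⟨ ℕₚ.^-*-assoc b q m ⟩
  b ^ (q * m)    ≤⟨ ℕₚ.^-monoʳ-≤ b {{ℕ.>-nonZero (ℕₚ.<-≤-trans (ℕₚ.m^n>0 2 q) 2^q≤b)}} q*m≤p ⟩
  b ^ p          ∎
  where
  open ℕₚ.≤-Reasoning
  q*m≤p : q * m ≤ p
  q*m≤p = ℕₚ.≮⇒≥ λ p<q*m → ℕₚ.<-irrefl refl (begin-strict
    2 ^ p          ≤⟨ ℕₚ.^-monoʳ-≤ 2 (ℕₚ.<⇒≤ p<q*m) ⟩
    2 ^ (q * m)    ≡⟨ sym (ℕₚ.^-*-assoc 2 q m) ⟩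
    (2 ^ q) ^ m    ≤⟨ ℕₚ.^-monoˡ-≤ m 2^q≤b ⟩
    b ^ m          <⟨ b^m<2^p ⟩
    2 ^ p          ∎)

boundByΔPowLog : ∀ {Δ c k q} {r : ℚ} → k < q → 2 ^ q ≤ Δ → 1 ≤ c →
  0ℚ ℚ.≤ r → r ℚ.≤ fromℤ (+ (2 ^ k)) → BoundByΔPowLog Δ c r
boundByΔPowLog {Δ} {c} {k} {q} {r} k<q 2^q≤Δ 1≤c 0≤r r≤2^k p m _ Δ^m<2^p
  rewrite /1≡fromℤ (+ Δ) | /1≡fromℤ (+ c) = begin
    (r ℚ.* fromℤ (+ Δ)) ^ℚ m
      ≤⟨ ^ℚ-mono-≤ m (0≤p*q 0≤r (0≤fromℤ-pos Δ)) rΔ≤Δ^q ⟩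
    fromℤ (+ (Δ ^ q)) ^ℚ m
      ≡⟨ fromℤ-^ℚ (Δ ^ q) m ⟩
    fromℤ (+ ((Δ ^ q) ^ m))
      ≤⟨ fromℤ-mono-≤ (ℤ.+≤+ (2^q≤b⇒b^m<2^p⇒[b^q]^m≤b^p q m p 2^q≤Δ Δ^m<2^p)) ⟩
    fromℤ (+ (Δ ^ p))
      ≤⟨ fromℤ-mono-≤ (ℤ.+≤+ (ℕₚ.m≤n*m (Δ ^ p) (c ^ m) {{ℕₚ.m^n≢0 c m {{ℕ.>-nonZero 1≤c}}}})) ⟩
    fromℤ (+ (c ^ m * Δ ^ p))
      ≡⟨ fromℤ-pos-* (c ^ m) (Δ ^ p) ⟩
    fromℤ (+ (c ^ m)) ℚ.* fromℤ (+ (Δ ^ p))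
      ≡⟨ sym (cong₂ ℚ._*_ (fromℤ-^ℚ c m) (fromℤ-^ℚ Δ p)) ⟩
    fromℤ (+ c) ^ℚ m ℚ.* fromℤ (+ Δ) ^ℚ p
      ∎
  where
  open ℚₚ.≤-Reasoning
  2≤Δ : 2 ≤ Δ
  2≤Δ = ℕₚ.≤-trans (ℕₚ.^-monoʳ-≤ 2 (ℕₚ.≤-trans (s≤s z≤n) k<q)) 2^q≤Δ
  rΔ≤Δ^q : r ℚ.* fromℤ (+ Δ) ℚ.≤ fromℤ (+ (Δ ^ q))
  rΔ≤Δ^q = begin
    r ℚ.* fromℤ (+ Δ)                     ≤⟨ *-monoʳ-≤-0≤ (0≤fromℤ-pos Δ) r≤2^k ⟩
    fromℤ (+ (2 ^ k)) ℚ.* fromℤ (+ Δ)     ≡⟨ sym (fromℤ-pos-* (2 ^ k) Δ) ⟩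
    fromℤ (+ (2 ^ k * Δ))                 ≤⟨ fromℤ-mono-≤ (ℤ.+≤+ (2^k*b≤b^q k<q 2≤Δ)) ⟩
    fromℤ (+ (Δ ^ q))                     ∎

lemma2 : (Δ : ℕ) → 1 ≤ Δ →
  (n : ℕ) (H : Mat ℤ n) → IsHNF H →
  + 1 ℤ.< det H → det H ℤ.≤ + Δ →
  (q : ℕ) → 1 ≤ q → q ≤ n →
  ((i : Fin n) → toℕ i < n ∸ q → H i i ≡ + 1) →
  ((i : Fin n) → n ∸ q ≤ toℕ i → + 1 ℤ.< H i i) →
  (G : Mat ℚ n) → IsInverse H G →
  (q ≤ ⌊log₂ Δ ⌋)
  × ((j : Fin n) → nnzCol G j ≤ suc q)
  × ((i j : Fin n) → ∃ λ (z : ℤ) → G i j ℚ.* (det H ℚ./ 1) ≡ z ℚ./ 1)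
  × ((i j : Fin n) → BoundByΔPowLog Δ (⌈log₂ Δ ⌉ !) (ℚ.∣ G i j ∣))
lemma2 Δ _ n H hnf _ det≤Δ q 1≤q q≤n unit big G inverse =
  subst (_≤ ⌊log₂ Δ ⌋) (⌊log₂[2^n]⌋≡n q) (⌊log₂⌋-mono-≤ 2^q≤Δ) ,
  (λ j → subst (λ e → nnzCol G j ≤ suc e) (ℕₚ.m∸[m∸n]≡n q≤n) (nnzCol-inverse-≤ hnf unit inverse j)) ,
  integral ,
  λ i j → boundByΔPowLog (exponent<q i) 2^q≤Δ (ℕₚ.1≤n! ⌈log₂ Δ ⌉) (ℚₚ.0≤∣p∣ (G i j))
            (∣inverse∣≤2^ hnf (n ∸ q) unit inverse i j)
  where
  2^q≤Δ : 2 ^ q ≤ Δ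
  2^q≤Δ = ℤₚ.drop‿+≤+ (ℤₚ.≤-trans (2^q≤det hnf q≤n big) det≤Δ)

  exponent<q : ∀ (i : Fin n) → toℕ i ∸ (n ∸ q) < q
  exponent<q i = ℕₚ.m<n+o⇒m∸n<o (toℕ i) (n ∸ q) {{ℕ.>-nonZero 1≤q}}
    (subst (toℕ i <_) (sym (ℕₚ.m∸n+n≡m q≤n)) (Finₚ.toℕ<n i))

  integral : ∀ i j → ∃ λ (z : ℤ) → G i j ℚ.* (det H ℚ./ 1) ≡ z ℚ./ 1
  integral i j with det*inverse-isInt (proj₁ hnf) inverse i j
  ... | z , detG≡z = z , (begin-equality
    G i j ℚ.* (det H ℚ./ 1)          ≡⟨ cong (G i j ℚ.*_) (/1≡fromℤ (det H)) ⟩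
    G i j ℚ.* fromℤ (det H)          ≡⟨ ℚₚ.*-comm (G i j) (fromℤ (det H)) ⟩
    fromℤ (det H) ℚ.* G i j          ≡⟨ detG≡z ⟩
    fromℤ z                          ≡⟨ sym (/1≡fromℤ z) ⟩
    z ℚ./ 1                          ∎)
    where open ℚₚ.≤-Reasoning
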